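{- Let $(a(n))_{n\ge 1}$ be the lexicographically least strictly increasing sequence of positive integers with the property that, for every $n\ge 1$, $n$ is a term of the sequence if and only if $a(n)$ is odd. Then $a(a(1))=1$ and $a(a(n))=2n+3$ for all $n\ge 2$.
   Context: The paper defines $a(n)$ greedily: $a(n)$ is the smallest positive integer greater than $a(n-1)$ that is consistent with (i.e. still allows an infinite continuation satisfying) the condition "$n$ is a member of the sequence if and only if $a(n)$ is odd"; this is the same as the lexicographically least such sequence. -}

module Defs where

open import Data.Nat using (ℕ; zero; suc; _+_; _*_; _≤_; _<_)
open import Data.Product using (Σ; ∃; _×_; _,_)
open import Data.Sum using (_⊎_)
open import Relation.Binary.PropositionalEquality using (_≡_)
open import Function.Bundles using (_⇔_)

-- Sequences a(1), a(2), ... are modelled as functions ℕ → ℕ;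
-- the value at index 0 is irrelevant and never constrained or compared.
Seq : Set
Seq = ℕ → ℕ

Odd : ℕ → Set
Odd n = ∃ λ k → n ≡ suc (2 * k)

IsTerm : Seq → ℕ → Set
IsTerm a n = ∃ λ k → 1 ≤ k × a k ≡ n

Admissible : Seq → Set
Admissible a =
  (∀ n → 1 ≤ n → 1 ≤ a n) ×
  (∀ n → 1 ≤ n → a n < a (suc n)) ×
  (∀ n → 1 ≤ n → (IsTerm a n ⇔ Odd (a n)))

_≤lex_ : Seq → Seq → Set
a ≤lex b =
  (∀ i → 1 ≤ i → a i ≡ b i) ⊎
  (∃ λ m → 1 ≤ m × (∀ i → 1 ≤ i → i < m → a i ≡ b i) × a m < b m)

LexLeastAdmissible : Seq → Set
LexLeastAdmissible a = Admissible a × (∀ b → Admissible b → a ≤lex b)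

-- A prefix a(1), …, a(k) of an admissible sequence with k ≥ 2 and a(j) > j can always be
-- continued greedily: choose each next value as a(j) + 1 or a(j) + 2, whichever is odd exactly
-- when j + 1 already occurs among a(1), …, a(j). Comparing with such continuations, lexicographic
-- minimality forces a(1) = 1, a(2) = 4 and a(k+1) ≤ a(k) + 2. The parity condition then says that
-- the gap a(k+1) − a(k) is 2 exactly when k and k+1 are both terms or both non-terms. At k = a(n):
-- if a(n+1) = a(n) + 1, two consecutive terms give a gap of 2; if a(n+1) = a(n) + 2, the non-term
-- a(n) + 1 sits between two terms and gives two gaps of 1. Either way a(a(n+1)) = a(a(n)) + 2,
-- and a(a(2)) = a(4) = 7 starts the induction.
module Submission where

open import Defs
open import Data.Bool using (Bool; true; false; not; _xor_; if_then_else_)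
open import Data.Bool.Properties using (not-¬; ¬-not; not-involutive)
open import Data.Empty using (⊥-elim)
open import Data.Nat using (ℕ; zero; suc; _+_; _*_; _∸_; _≤_; _<_; z≤n; s≤s; s≤s⁻¹; _≤?_; _<?_; _≟_; anyUpTo?)
open import Data.Nat.Properties
open import Data.Product using (_×_; _,_; proj₁; proj₂; ∃)
open import Data.Sum using (_⊎_; inj₁; inj₂)
open import Function using (_∘_)
open import Function.Bundles using (_⇔_; mk⇔; Equivalence)
open import Function.Properties.Equivalence using (⇔-setoid)
open import Level using (0ℓ)
open import Relation.Binary.Definitions using (tri<; tri≈; tri>)
open import Relation.Binary.PropositionalEquality
open import Relation.Nullary using (¬_; Dec; yes; no; does; contradiction)
open import Relation.Nullary.Decidable using (dec-true; dec-false; does-⇔)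
import Relation.Binary.Reasoning.Setoid as SetoidReasoning

open Equivalence using (to; from)

module ⇔-Reasoning = SetoidReasoning (⇔-setoid 0ℓ)

private
  variable
    A : Set
    s t : Seq
    k m n : ℕ

does≡true⇔ : (d : Dec A) → (does d ≡ true) ⇔ A
does≡true⇔ (yes a) = mk⇔ (λ _ → a) (λ _ → refl)
does≡true⇔ (no ¬a) = mk⇔ (λ ()) (λ a → contradiction a ¬a)

isOdd : ℕ → Bool
isOdd zero = false
isOdd (suc n) = not (isOdd n)

isOdd-double : ∀ k → isOdd (2 * k) ≡ false
isOdd-double zero = refl
isOdd-double (suc k) rewrite +-suc k (k + 0) | isOdd-double k = refl

isOdd⇒odd : ∀ n → isOdd n ≡ true → Odd n
isOdd⇒odd zero ()
isOdd⇒odd (suc zero) _ = 0 , refl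
isOdd⇒odd (suc (suc n)) h with isOdd⇒odd n (trans (sym (not-involutive (isOdd n))) h)
... | k , refl = suc k , cong (suc ∘ suc) (sym (+-suc k (k + 0)))

odd⇔isOdd : ∀ n → Odd n ⇔ (isOdd n ≡ true)
odd⇔isOdd n = mk⇔ (λ { (k , refl) → cong not (isOdd-double k) }) (isOdd⇒odd n)

-- The least number above v whose oddness is b: v + 1 qualifies iff b differs from the oddness of v.
nextWithOddness : Bool → ℕ → ℕ
nextWithOddness b v = if b xor isOdd v then suc v else suc (suc v)

isOdd-nextWithOddness : ∀ b v → isOdd (nextWithOddness b v) ≡ b
isOdd-nextWithOddness false v with isOdd v in eq
... | false rewrite eq = refl
... | true rewrite eq = refl
isOdd-nextWithOddness true v with isOdd v in eq
... | false rewrite eq = refl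
... | true rewrite eq = refl

<-nextWithOddness : ∀ b v → v < nextWithOddness b v
<-nextWithOddness b v with b xor isOdd v
... | true = ≤-refl
... | false = n≤1+n (suc v)

nextWithOddness-≤ : ∀ b v → nextWithOddness b v ≤ 2 + v
nextWithOddness-≤ b v with b xor isOdd v
... | true = n≤1+n (suc v)
... | false = ≤-refl

StrictlyIncreasing : Seq → Set
StrictlyIncreasing s = ∀ n → 1 ≤ n → s n < s (suc n)

Expanding : Seq → Set
Expanding s = ∀ n → 2 ≤ n → n < s n

AdmissibleUpTo : ℕ → Seq → Set
AdmissibleUpTo m s =
  (∀ n → 1 ≤ n → 1 ≤ s n) ×
  StrictlyIncreasing s ×
  (∀ n → 1 ≤ n → n ≤ m → (IsTerm s n ⇔ Odd (s n)))

admissible⇒admissibleUpTo : Admissible s → AdmissibleUpTo m s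
admissible⇒admissibleUpTo (positive , increasing , term⇔odd) =
  positive , increasing , λ n 1≤n _ → term⇔odd n 1≤n

module Monotone (increasing : StrictlyIncreasing s) where

  mono-< : ∀ {i} j → 1 ≤ i → i < j → s i < s j
  mono-< (suc j) 1≤i i<1+j with m≤n⇒m<n∨m≡n (s≤s⁻¹ i<1+j)
  ... | inj₁ i<j = <-trans (mono-< j 1≤i i<j) (increasing j (≤-trans 1≤i (<⇒≤ i<j)))
  ... | inj₂ refl = increasing j 1≤i

  mono-≤ : ∀ {i j} → 1 ≤ i → i ≤ j → s i ≤ s j
  mono-≤ {j = j} 1≤i i≤j with m≤n⇒m<n∨m≡n i≤j
  ... | inj₁ i<j = <⇒≤ (mono-< j 1≤i i<j)
  ... | inj₂ refl = ≤-refl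

  expanding-from : ∀ {i} → 1 ≤ i → i < s i → ∀ j → i ≤ j → j < s j
  expanding-from 1≤i i<si zero z≤n = i<si
  expanding-from 1≤i i<si (suc j) i≤1+j with m≤n⇒m<n∨m≡n i≤1+j
  ... | inj₁ i<1+j = ≤-trans (s≤s (expanding-from 1≤i i<si j i≤j)) (increasing j (≤-trans 1≤i i≤j))
    where i≤j = s≤s⁻¹ i<1+j
  ... | inj₂ refl = i<si

  not-term-between : ∀ {i x} → 1 ≤ i → s i < x → x < s (suc i) → ¬ IsTerm s x
  not-term-between {i} 1≤i si<x x<s1+i (j , 1≤j , sj≡x) with j ≤? i
  ... | yes j≤i = <-irrefl sj≡x (≤-<-trans (mono-≤ 1≤j j≤i) si<x)
  ... | no j≰i = <-irrefl (sym sj≡x) (<-≤-trans x<s1+i (mono-≤ (s≤s z≤n) (≰⇒> j≰i)))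

IsTermAmongFirst : ℕ → Seq → ℕ → Set
IsTermAmongFirst m s n = ∃ λ j → j < m × s (suc j) ≡ n

isTermAmongFirst? : ∀ m s n → Dec (IsTermAmongFirst m s n)
isTermAmongFirst? m s n = anyUpTo? (λ j → s (suc j) ≟ n) m

termAmongFirst⇒term : IsTermAmongFirst m s n → IsTerm s n
termAmongFirst⇒term (j , _ , sj≡n) = suc j , s≤s z≤n , sj≡n

term⇒termAmongFirst : Expanding s → 1 ≤ m → n ≤ suc m → IsTerm s n → IsTermAmongFirst m s n
term⇒termAmongFirst {s = s} {m = m} {n = n} expanding 1≤m n≤1+m (suc j , _ , sj≡n) with j <? m
... | yes j<m = j , j<m , sj≡n
... | no j≮m = ⊥-elim (<-irrefl refl (begin-strict
    suc j      <⟨ expanding (suc j) (s≤s (≤-trans 1≤m m≤j)) ⟩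
    s (suc j)  ≡⟨ sj≡n ⟩
    n          ≤⟨ n≤1+m ⟩
    suc m      ≤⟨ s≤s m≤j ⟩
    suc j      ∎))
  where
  open ≤-Reasoning
  m≤j = ≮⇒≥ j≮m

term-transfer : Expanding s → 1 ≤ m → (∀ j → 1 ≤ j → j ≤ m → s j ≡ t j) →
                n ≤ m → IsTerm s n → IsTerm t n
term-transfer expanding 1≤m agree n≤m term
  with term⇒termAmongFirst expanding 1≤m (m≤n⇒m≤1+n n≤m) term
... | j , j<m , sj≡n = suc j , s≤s z≤n , trans (sym (agree (suc j) (s≤s z≤n) j<m)) sj≡n

greedyStep : Seq → ℕ → ℕ
greedyStep s k = nextWithOddness (does (isTermAmongFirst? k s (suc k))) (s k)

<-greedyStep : ∀ s k → s k < greedyStep s k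
<-greedyStep s k = <-nextWithOddness (does (isTermAmongFirst? k s (suc k))) (s k)

greedyStep-≤ : ∀ s k → greedyStep s k ≤ 2 + s k
greedyStep-≤ s k = nextWithOddness-≤ (does (isTermAmongFirst? k s (suc k))) (s k)

isOdd-greedyStep : ∀ s k → isOdd (greedyStep s k) ≡ does (isTermAmongFirst? k s (suc k))
isOdd-greedyStep s k = isOdd-nextWithOddness (does (isTermAmongFirst? k s (suc k))) (s k)

greedyStep-cong : ∀ k → (∀ j → j ≤ k → s j ≡ t j) → greedyStep s k ≡ greedyStep t k
greedyStep-cong {s} {t} k agree = cong₂ nextWithOddness
  (does-⇔ amongFirst⇔ (isTermAmongFirst? k s (suc k)) (isTermAmongFirst? k t (suc k)))
  (agree k ≤-refl)
  where
  transport : ∀ {f g} → (∀ j → j ≤ k → f j ≡ g j) →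
              IsTermAmongFirst k f (suc k) → IsTermAmongFirst k g (suc k)
  transport f≡g (j , j<k , fj≡x) = j , j<k , trans (sym (f≡g (suc j) j<k)) fj≡x
  amongFirst⇔ = mk⇔ (transport agree) (transport (λ j j≤k → sym (agree j j≤k)))

module Greedy (p : Seq) (m : ℕ) where

  -- extendedBy d is p with the values at m+1, …, m+d replaced by greedy steps;
  -- greedy j is read off the first stage that fixes index j.
  extendedBy : ℕ → Seq
  extendedBy zero = p
  extendedBy (suc d) j =
    if does (j ≤? m + d) then extendedBy d j else greedyStep (extendedBy d) (m + d)

  greedy : Seq
  greedy j = extendedBy (j ∸ m) j

  extendedBy-stable : ∀ e d {j} → j ≤ m + d → extendedBy (e + d) j ≡ extendedBy d j
  extendedBy-stable zero d _ = refl
  extendedBy-stable (suc e) d {j} j≤m+d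
    rewrite dec-true (j ≤? m + (e + d)) (≤-trans j≤m+d (+-monoʳ-≤ m (m≤n+m d e))) =
    extendedBy-stable e d j≤m+d

  greedy-extendedBy : ∀ d {j} → j ≤ m + d → greedy j ≡ extendedBy d j
  greedy-extendedBy d {j} j≤m+d = begin
    greedy j                                ≡⟨ extendedBy-stable (d ∸ (j ∸ m)) (j ∸ m) (m≤n+m∸n j m) ⟨
    extendedBy ((d ∸ (j ∸ m)) + (j ∸ m)) j  ≡⟨ cong (λ e → extendedBy e j) (m∸n+n≡m j∸m≤d) ⟩
    extendedBy d j                          ∎
    where
    open ≡-Reasoning
    j∸m≤d = subst (j ∸ m ≤_) (m+n∸m≡n m d) (∸-monoˡ-≤ m j≤m+d)

  greedy-prefix : ∀ {j} → j ≤ m → greedy j ≡ p j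
  greedy-prefix {j} j≤m = greedy-extendedBy 0 (subst (j ≤_) (sym (+-identityʳ m)) j≤m)

  greedy-step : m ≤ k → greedy (suc k) ≡ greedyStep greedy k
  greedy-step {k} m≤k =
    subst (λ k → greedy (suc k) ≡ greedyStep greedy k) (m+[n∸m]≡n m≤k) (step (k ∸ m))
    where
    open ≡-Reasoning
    step : ∀ d → greedy (suc (m + d)) ≡ greedyStep greedy (m + d)
    step d = begin
      greedy (suc (m + d))
        ≡⟨ greedy-extendedBy (suc d) (≤-reflexive (sym (+-suc m d))) ⟩
      extendedBy (suc d) (suc (m + d))
        ≡⟨ cong (λ b → if b then extendedBy d (suc (m + d)) else greedyStep (extendedBy d) (m + d))
             (dec-false (suc (m + d) ≤? m + d) (n≮n (m + d))) ⟩
      greedyStep (extendedBy d) (m + d)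
        ≡⟨ greedyStep-cong (m + d) (λ j j≤m+d → sym (greedy-extendedBy d j≤m+d)) ⟩
      greedyStep greedy (m + d)
        ∎

  greedy-next-≤ : greedy (suc m) ≤ 2 + p m
  greedy-next-≤ rewrite greedy-step ≤-refl | sym (greedy-prefix {m} ≤-refl) = greedyStep-≤ greedy m

  isOdd-greedy-step : m ≤ k → isOdd (greedy (suc k)) ≡ does (isTermAmongFirst? k greedy (suc k))
  isOdd-greedy-step {k} m≤k = trans (cong isOdd (greedy-step m≤k)) (isOdd-greedyStep greedy k)

  module _ (2≤m : 2 ≤ m) (admissible : AdmissibleUpTo m p) (expanding : Expanding p) where

    private
      1≤m : 1 ≤ m
      1≤m = <⇒≤ 2≤m

    greedy-increasing : StrictlyIncreasing greedy
    greedy-increasing n 1≤n with suc n ≤? m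
    ... | yes n<m = subst₂ _<_ (sym (greedy-prefix (<⇒≤ n<m))) (sym (greedy-prefix n<m))
                      (proj₁ (proj₂ admissible) n 1≤n)
    ... | no n≮m = subst (greedy n <_) (sym (greedy-step (≮⇒≥ n≮m))) (<-greedyStep greedy n)

    open Monotone greedy-increasing

    greedy-positive : ∀ n → 1 ≤ n → 1 ≤ greedy n
    greedy-positive n 1≤n =
      ≤-trans (subst (1 ≤_) (sym (greedy-prefix 1≤m)) (proj₁ admissible 1 ≤-refl)) (mono-≤ ≤-refl 1≤n)

    greedy-expanding : Expanding greedy
    greedy-expanding n 2≤n with n ≤? m
    ... | yes n≤m = subst (n <_) (sym (greedy-prefix n≤m)) (expanding n 2≤n)
    ... | no n≰m = expanding-from 1≤m (subst (m <_) (sym (greedy-prefix ≤-refl)) (expanding m 2≤m))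
                     n (<⇒≤ (≰⇒> n≰m))

    greedy-term⇔odd : ∀ n → 1 ≤ n → IsTerm greedy n ⇔ Odd (greedy n)
    greedy-term⇔odd n 1≤n with n ≤? m
    ... | yes n≤m = begin
      IsTerm greedy n  ≈⟨ mk⇔ (term-transfer greedy-expanding 1≤m (λ _ _ → greedy-prefix) n≤m)
                              (term-transfer expanding 1≤m (λ _ _ → sym ∘ greedy-prefix) n≤m) ⟩
      IsTerm p n       ≈⟨ proj₂ (proj₂ admissible) n 1≤n n≤m ⟩
      Odd (p n)        ≡⟨ cong Odd (greedy-prefix n≤m) ⟨
      Odd (greedy n)   ∎
      where open ⇔-Reasoning
    greedy-term⇔odd (suc k) _ | no 1+k≰m = begin
      IsTerm greedy (suc k)
        ≈⟨ mk⇔ (term⇒termAmongFirst greedy-expanding 1≤k ≤-refl) termAmongFirst⇒term ⟩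
      IsTermAmongFirst k greedy (suc k)
        ≈⟨ does≡true⇔ (isTermAmongFirst? k greedy (suc k)) ⟨
      does (isTermAmongFirst? k greedy (suc k)) ≡ true
        ≡⟨ cong (_≡ true) (isOdd-greedy-step m≤k) ⟨
      isOdd (greedy (suc k)) ≡ true
        ≈⟨ odd⇔isOdd (greedy (suc k)) ⟨
      Odd (greedy (suc k))
        ∎
      where
      open ⇔-Reasoning
      m≤k = s≤s⁻¹ (≰⇒> 1+k≰m)
      1≤k = ≤-trans 1≤m m≤k

    greedy-admissible : Admissible greedy
    greedy-admissible = greedy-positive , greedy-increasing , greedy-term⇔odd

≤lex⇒≤ : ∀ {a b} → a ≤lex b → 1 ≤ m → (∀ i → 1 ≤ i → i < m → a i ≡ b i) → a m ≤ b m
≤lex⇒≤ (inj₁ a≡b) 1≤m _ = ≤-reflexive (a≡b _ 1≤m)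
≤lex⇒≤ {m} (inj₂ (j , 1≤j , a≡b , aj<bj)) 1≤m agree with <-cmp j m
... | tri< j<m _ _ = contradiction (agree j 1≤j j<m) (<⇒≢ aj<bj)
... | tri≈ _ refl _ = <⇒≤ aj<bj
... | tri> _ _ m<j = ≤-reflexive (a≡b m 1≤m m<j)

-- Only seed 1 = 1 and seed 2 = 4 matter; the tail n ↦ n + 2 keeps the seed increasing and expanding.
seed : Seq
seed (suc zero) = 1
seed n = 2 + n

seed-admissibleUpTo : AdmissibleUpTo 2 seed
seed-admissibleUpTo = positive , increasing , term⇔odd
  where
  positive : ∀ n → 1 ≤ n → 1 ≤ seed n
  positive (suc zero) _ = s≤s z≤n
  positive (suc (suc n)) _ = s≤s z≤n

  increasing : StrictlyIncreasing seed
  increasing (suc zero) _ = s≤s (s≤s z≤n)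
  increasing (suc (suc n)) _ = ≤-refl

  term⇔odd : ∀ n → 1 ≤ n → n ≤ 2 → IsTerm seed n ⇔ Odd (seed n)
  term⇔odd (suc zero) _ _ = mk⇔ (λ _ → 0 , refl) (λ _ → 1 , s≤s z≤n , refl)
  term⇔odd (suc (suc zero)) _ _ = mk⇔ (λ { (suc zero , _ , ()) ; (suc (suc _) , _ , ()) })
                                      (λ odd → contradiction (to (odd⇔isOdd 4) odd) λ ())
  term⇔odd (suc (suc (suc _))) _ (s≤s (s≤s ()))

seed-expanding : Expanding seed
seed-expanding (suc zero) (s≤s ())
seed-expanding (suc (suc n)) _ = n≤1+n _

module LexLeast (a : Seq) (least : LexLeastAdmissible a) where

  open Monotone (proj₁ (proj₂ (proj₁ least)))

  positive : ∀ n → 1 ≤ n → 1 ≤ a n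
  positive = proj₁ (proj₁ least)

  term⇔odd : ∀ n → 1 ≤ n → IsTerm a n ⇔ Odd (a n)
  term⇔odd = proj₂ (proj₂ (proj₁ least))

  isOdd-term : 1 ≤ n → IsTerm a n → isOdd (a n) ≡ true
  isOdd-term {n} 1≤n = to (odd⇔isOdd (a n)) ∘ to (term⇔odd n 1≤n)

  isOdd-not-term : 1 ≤ n → ¬ IsTerm a n → isOdd (a n) ≡ false
  isOdd-not-term {n} 1≤n ¬term = ¬-not (¬term ∘ from (term⇔odd n 1≤n) ∘ from (odd⇔isOdd (a n)))

  ≤-admissible : ∀ b → Admissible b → 1 ≤ m → (∀ i → 1 ≤ i → i < m → a i ≡ b i) → a m ≤ b m
  ≤-admissible b admissible = ≤lex⇒≤ (proj₂ least b admissible)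

  module Seed = Greedy seed 2

  ≤-seed : 1 ≤ m → (∀ i → 1 ≤ i → i < m → a i ≡ Seed.greedy i) → a m ≤ Seed.greedy m
  ≤-seed = ≤-admissible Seed.greedy (Seed.greedy-admissible ≤-refl seed-admissibleUpTo seed-expanding)

  a1≡1 : a 1 ≡ 1
  a1≡1 = ≤-antisym
    (subst (a 1 ≤_) (Seed.greedy-prefix (s≤s z≤n)) (≤-seed ≤-refl λ { _ (s≤s z≤n) (s≤s ()) }))
    (positive 1 ≤-refl)

  a2≡4 : a 2 ≡ 4
  a2≡4 = ≤-antisym a2≤4 (≤∧≢⇒< (≤∧≢⇒< 2≤a2 2≢a2) 3≢a2)
    where
    a2≤4 : a 2 ≤ 4
    a2≤4 = subst (a 2 ≤_) (Seed.greedy-prefix ≤-refl)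
                 (≤-seed (s≤s z≤n) λ { (suc zero) _ _ → trans a1≡1 (sym (Seed.greedy-prefix (s≤s z≤n)))
                                     ; (suc (suc _)) _ (s≤s (s≤s ())) })
    2≤a2 : 2 ≤ a 2
    2≤a2 = subst (_< a 2) a1≡1 (mono-< 2 ≤-refl ≤-refl)
    2≢a2 : 2 ≢ a 2
    2≢a2 2≡a2 = contradiction
      (trans (cong isOdd 2≡a2) (isOdd-term (s≤s z≤n) (2 , s≤s z≤n , sym 2≡a2))) λ ()
    3≢a2 : 3 ≢ a 2
    3≢a2 3≡a2 = not-term-between ≤-refl (subst (_< 2) (sym a1≡1) ≤-refl) (subst (2 <_) 3≡a2 ≤-refl)
                  (from (term⇔odd 2 (s≤s z≤n)) (subst Odd 3≡a2 (1 , refl)))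

  expanding : Expanding a
  expanding = expanding-from (s≤s z≤n) (subst (2 <_) (sym a2≡4) (s≤s (s≤s (s≤s z≤n))))

  next-≤ : ∀ k → 2 ≤ k → a (suc k) ≤ 2 + a k
  next-≤ k 2≤k = ≤-trans
    (≤-admissible E.greedy (E.greedy-admissible 2≤k (admissible⇒admissibleUpTo (proj₁ least)) expanding)
       (s≤s z≤n) (λ i _ i<1+k → sym (E.greedy-prefix (s≤s⁻¹ i<1+k))))
    E.greedy-next-≤
    where module E = Greedy a k

  gap : ∀ k → 2 ≤ k → a (suc k) ≡ suc (a k) ⊎ a (suc k) ≡ 2 + a k
  gap k 2≤k with m≤n⇒m<n∨m≡n (next-≤ k 2≤k)
  ... | inj₁ a1+k<2+ak = inj₁ (≤-antisym (s≤s⁻¹ a1+k<2+ak) (mono-< (suc k) (<⇒≤ 2≤k) ≤-refl))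
  ... | inj₂ a1+k≡2+ak = inj₂ a1+k≡2+ak

  2≤a : 2 ≤ n → 2 ≤ a n
  2≤a {n} 2≤n = ≤-trans 2≤n (<⇒≤ (expanding n 2≤n))

  isOdd-aa : 1 ≤ n → isOdd (a (a n)) ≡ true
  isOdd-aa {n} 1≤n = isOdd-term (positive n 1≤n) (n , 1≤n , refl)

  gap-same : ∀ {b} k → 2 ≤ k → isOdd (a k) ≡ b → isOdd (a (suc k)) ≡ b → a (suc k) ≡ 2 + a k
  gap-same k 2≤k ak≡b a1+k≡b with gap k 2≤k
  ... | inj₁ e = contradiction (trans ak≡b (sym (trans (cong isOdd (sym e)) a1+k≡b))) (not-¬ refl)
  ... | inj₂ e = e

  gap-flip : ∀ {b} k → 2 ≤ k → isOdd (a k) ≡ b → isOdd (a (suc k)) ≡ not b → a (suc k) ≡ suc (a k)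
  gap-flip k 2≤k ak≡b a1+k≡¬b with gap k 2≤k
  ... | inj₁ e = e
  ... | inj₂ e = contradiction
    (trans (sym (not-involutive _)) (trans (cong isOdd (sym e)) a1+k≡¬b)) (not-¬ ak≡b)

  aa2≡7 : a (a 2) ≡ 7
  aa2≡7 = begin
    a (a 2)    ≡⟨ cong a a2≡4 ⟩
    a 4        ≡⟨ gap-flip 3 (n≤1+n 2) (isOdd-below-a2 (n≤1+n 2) ≤-refl)
                            (isOdd-term (s≤s z≤n) (2 , s≤s z≤n , a2≡4)) ⟩
    suc (a 3)  ≡⟨ cong suc (gap-same 2 ≤-refl (isOdd-below-a2 ≤-refl (n≤1+n 3))
                                              (isOdd-below-a2 (n≤1+n 2) ≤-refl)) ⟩
    3 + a 2    ≡⟨ cong (3 +_) a2≡4 ⟩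
    7          ∎
    where
    open ≡-Reasoning
    isOdd-below-a2 : ∀ {x} → 1 < x → x < 4 → isOdd (a x) ≡ false
    isOdd-below-a2 {x} 1<x x<4 = isOdd-not-term (<⇒≤ 1<x)
      (not-term-between ≤-refl (subst (_< x) (sym a1≡1) 1<x) (subst (x <_) (sym a2≡4) x<4))

  aa-step : ∀ n → 2 ≤ n → a (a (suc n)) ≡ 2 + a (a n)
  aa-step n 2≤n with gap n 2≤n
  ... | inj₁ e = begin
    a (a (suc n))        ≡⟨ cong a e ⟩
    a (suc (a n))        ≡⟨ gap-same (a n) (2≤a 2≤n) (isOdd-aa (<⇒≤ 2≤n))
                              (isOdd-term (s≤s z≤n) (suc n , s≤s z≤n , e)) ⟩
    2 + a (a n)          ∎
    where open ≡-Reasoning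
  ... | inj₂ e = begin
    a (a (suc n))        ≡⟨ cong a e ⟩
    a (2 + a n)          ≡⟨ gap-flip (suc (a n)) (m≤n⇒m≤1+n (2≤a 2≤n)) isOdd-between
                              (isOdd-term (s≤s z≤n) (suc n , s≤s z≤n , e)) ⟩
    suc (a (suc (a n)))  ≡⟨ cong suc (gap-flip (a n) (2≤a 2≤n) (isOdd-aa (<⇒≤ 2≤n)) isOdd-between) ⟩
    2 + a (a n)          ∎
    where
    open ≡-Reasoning
    isOdd-between : isOdd (a (suc (a n))) ≡ false
    isOdd-between = isOdd-not-term (s≤s z≤n) (not-term-between (<⇒≤ 2≤n) ≤-refl (≤-reflexive (sym e)))

  aa-formula : ∀ n → 2 ≤ n → a (a n) ≡ 2 * n + 3
  aa-formula (suc zero) (s≤s ())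
  aa-formula (suc (suc zero)) _ = aa2≡7
  aa-formula (suc (suc (suc n))) _ = begin
    a (a (3 + n))          ≡⟨ aa-step (2 + n) (s≤s (s≤s z≤n)) ⟩
    2 + a (a (2 + n))      ≡⟨ cong (2 +_) (aa-formula (suc (suc n)) (s≤s (s≤s z≤n))) ⟩
    2 + (2 * (2 + n) + 3)  ≡⟨ cong (_+ 3) (*-suc 2 (2 + n)) ⟨
    2 * (3 + n) + 3        ∎
    where open ≡-Reasoning

mainTheorem2 : (a : Seq) → LexLeastAdmissible a →
    (a (a 1) ≡ 1) × (∀ n → 2 ≤ n → a (a n) ≡ 2 * n + 3)
mainTheorem2 a least = trans (cong a a1≡1) a1≡1 , aa-formula
  where open LexLeast a least
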